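{- Let $n\geq 2$ and $r\geq 2$ be integers, let $G=C_n^r=\langle e_1\rangle\oplus\cdots\oplus\langle e_r\rangle$ with each $e_i$ of order $n$, and let $$S_r=\prod_{\emptyset\neq\{i_1,\dots,i_k\}\subset[1,r]}(e_{i_1}+\cdots+e_{i_k})^{n-1},$$ the product running over all nonempty subsets of $[1,r]$. Then for every $m\in[1,n-1]$ and every $i\in[1,r]$, the sequence obtained from $S_r$ by removing $m$ copies of $e_i$ and adjoining one copy of the element $me_i$ contains no short zero-sum subsequence.
   Context: A sequence over $G$ is a finite unordered list of elements of $G$ with repetition allowed; $g^k$ denotes $k$ copies of $g$ and products denote concatenation. A short zero-sum subsequence is a subsequence with sum $0$ and length in $[1,\exp(G)]=[1,n]$. -}

module Defs where

open import Data.Nat using (ℕ; zero; suc; _≤_; _∸_)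
open import Data.Nat.Divisibility using (_∣_)
open import Data.Nat.Properties using (_≟_)
open import Data.Bool using (Bool; true; false; if_then_else_)
open import Data.Fin using (Fin)
open import Data.List using (List; []; _∷_; _++_; map; concatMap; filter; replicate; length)
open import Data.Vec using (Vec; []; _∷_; lookup; zipWith; tabulate)
import Data.Vec as V
import Data.Vec.Properties as VP
open import Data.List.Relation.Binary.Sublist.Propositional using (_⊆_)
open import Data.Product using (∃; _×_)
open import Relation.Nullary using (yes; no)
open import Relation.Binary.PropositionalEquality using (_≡_)
import Data.Fin as F

-- Elements of C_n^r = <e_1> ⊕ ... ⊕ <e_r> are represented by their
-- coordinate vectors of integer representatives (Vec ℕ r).  All elements that
-- occur below use canonical representatives in [0, n-1].
Elem : ℕ → Set
Elem r = Vec ℕ r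

vsum : ∀ {r} → List (Elem r) → Elem r
vsum {r} []       = V.replicate r 0
vsum     (x ∷ xs) = zipWith Data.Nat._+_ x (vsum xs)

-- the sum is 0 in C_n^r iff every coordinate is divisible by n
IsZeroMod : ∀ {r} → ℕ → Elem r → Set
IsZeroMod {r} n v = (j : Fin r) → n ∣ lookup v j

-- a short zero-sum subsequence of L in C_n^r (exp(G) = n)
HasShortZeroSum : ∀ {r} → ℕ → List (Elem r) → Set
HasShortZeroSum {r} n L =
  ∃ λ (T : List (Elem r)) → T ⊆ L × 1 ≤ length T × length T ≤ n × IsZeroMod n (vsum T)

e : ∀ {r} → Fin r → Elem r
e i = tabulate (λ j → if ⌊ i F.≟ j ⌋ then 1 else 0)
  where open import Relation.Nullary.Decidable using (⌊_⌋)

scal : ∀ {r} → ℕ → Fin r → Elem r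
scal m i = tabulate (λ j → if ⌊ i F.≟ j ⌋ then m else 0)
  where open import Relation.Nullary.Decidable using (⌊_⌋)

subsets : ∀ r → List (Vec Bool r)
subsets zero    = [] ∷ []
subsets (suc r) = map (false ∷_) (subsets r) ++ map (true ∷_) (subsets r)

nonempty : ∀ {r} → Vec Bool r → Bool
nonempty []          = false
nonempty (true ∷ _)  = true
nonempty (false ∷ s) = nonempty s

nonemptySubsets : ∀ r → List (Vec Bool r)
nonemptySubsets r = filter (λ s → Data.Bool._≟_ (nonempty s) true) (subsets r)

indicator : ∀ {r} → Vec Bool r → Elem r
indicator = V.map (λ b → if b then 1 else 0)

S : ℕ → (r : ℕ) → List (Elem r)
S n r = concatMap (λ s → replicate (n ∸ 1) (indicator s)) (nonemptySubsets r)

removeCopies : ∀ {r} → ℕ → Elem r → List (Elem r) → List (Elem r)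
removeCopies zero    x L        = L
removeCopies (suc m) x []       = []
removeCopies (suc m) x (y ∷ L) with VP.≡-dec _≟_ x y
... | yes _ = removeCopies m x L
... | no  _ = y ∷ removeCopies (suc m) x L

-- Every term of S_r is a nonzero 0-1 vector and, the nonempty subsets being
-- distinct, each occurs at most n - 1 times.  Read a zero-sum subsequence T of
-- length at most n column by column: a column of 0-1 entries has sum at most n
-- and divisible by n, hence 0 or n.  If T avoids m e_i, a nonzero coordinate of
-- one term forces |T| = n and then every column is constant, so T = x^n, which
-- is more copies of x than are available.  If T contains m e_i, its other terms
-- number fewer than n, so their columns j ≠ i vanish and they all equal e_i; at
-- most n - 1 - m copies of e_i are left, so the i-th coordinate of the sum lies
-- in [m, n - 1] and is not divisible by n.
module Submission where

open import Defs
open import Data.Nat using (ℕ; _≤_; _<_)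
open import Data.Fin using (Fin)
open import Data.List using (_∷_)
open import Relation.Nullary using (¬_)

open import Data.Nat using (suc; _+_; _*_; _∸_; z≤n; s≤s)
open import Data.Nat.Properties
open import Data.Nat.Divisibility using (_∣_; ∣⇒≤)
open import Data.Nat.ListAction using (sum)
open import Data.Bool using (Bool; true; false; if_then_else_)
import Data.Fin as F
open import Data.Product using (∃-syntax; _×_; _,_)
open import Data.Sum using (inj₁; inj₂)
open import Data.List using (List; []; _++_; map; concatMap; filter; replicate; length; [_])
open import Data.List.Properties
  using (length-map; length-++; filter-++; filter-all; filter-reject; filter-none)
open import Data.List.Membership.Propositional.Properties using (∈-map⁺; ∈-map⁻)
open import Data.List.Relation.Unary.All as All using (All; []; _∷_)
import Data.List.Relation.Unary.All.Properties as All
open import Data.List.Relation.Unary.Unique.Propositional using (Unique; []; _∷_)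
import Data.List.Relation.Unary.Unique.Propositional.Properties as Unique
open import Data.List.Relation.Binary.Disjoint.Propositional using (Disjoint)
open import Data.List.Relation.Binary.Sublist.Propositional using (_⊆_; []; _∷_; _∷ʳ_; ⊆-refl)
open import Data.List.Relation.Binary.Sublist.Propositional.Properties
  using (All-resp-⊆; filter⁺; length-mono-≤)
open import Data.Vec using (Vec; []; _∷_; lookup; tabulate)
import Data.Vec.Properties as VP
open import Function using (_∘_)
open import Relation.Nullary using (yes; no; contradiction)
open import Relation.Nullary.Decidable using (isYes≗does; dec-true; dec-false)
open import Relation.Binary.Definitions using (DecidableEquality)
open import Relation.Binary.PropositionalEquality
  using (_≡_; _≢_; refl; sym; trans; cong; cong₂; subst; module ≡-Reasoning)

module Multiplicity {a} {A : Set a} (_≟_ : DecidableEquality A) where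

  multiplicity : A → List A → ℕ
  multiplicity x xs = length (filter (x ≟_) xs)

  multiplicity-there : ∀ {x y} ys → x ≢ y → multiplicity x (y ∷ ys) ≡ multiplicity x ys
  multiplicity-there {x} ys x≢y = cong length (filter-reject (x ≟_) x≢y)

  multiplicity-mono : ∀ x {xs ys} → xs ⊆ ys → multiplicity x xs ≤ multiplicity x ys
  multiplicity-mono x xs⊆ys =
    length-mono-≤ (filter⁺ (x ≟_) (x ≟_) (λ a≡b x≡a → trans x≡a a≡b) xs⊆ys)

  multiplicity-++ : ∀ x xs ys →
    multiplicity x (xs ++ ys) ≡ multiplicity x xs + multiplicity x ys
  multiplicity-++ x xs ys =
    trans (cong length (filter-++ (x ≟_) xs ys)) (length-++ (filter (x ≟_) xs))

  all≡⇒multiplicity≡length : ∀ {x xs} → All (_≡ x) xs → multiplicity x xs ≡ length xs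
  all≡⇒multiplicity≡length {x} xs≡x = cong length (filter-all (x ≟_) (All.map sym xs≡x))

  multiplicity-replicate : ∀ x k y → multiplicity x (replicate k y) ≡ k * multiplicity x [ y ]
  multiplicity-replicate x 0       y = refl
  multiplicity-replicate x (suc k) y =
    trans (multiplicity-++ x [ y ] (replicate k y))
          (cong (multiplicity x [ y ] +_) (multiplicity-replicate x k y))

  multiplicity-concatMap-replicate : ∀ {b} {B : Set b} x k (f : B → A) ys →
    multiplicity x (concatMap (λ y → replicate k (f y)) ys) ≡ k * multiplicity x (map f ys)
  multiplicity-concatMap-replicate x k f []       = sym (*-zeroʳ k)
  multiplicity-concatMap-replicate x k f (y ∷ ys) = begin
    multiplicity x (replicate k (f y) ++ concatMap (λ y → replicate k (f y)) ys)
      ≡⟨ multiplicity-++ x (replicate k (f y)) _ ⟩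
    multiplicity x (replicate k (f y)) + multiplicity x (concatMap (λ y → replicate k (f y)) ys)
      ≡⟨ cong₂ _+_ (multiplicity-replicate x k (f y)) (multiplicity-concatMap-replicate x k f ys) ⟩
    k * multiplicity x [ f y ] + k * multiplicity x (map f ys)
      ≡⟨ *-distribˡ-+ k _ _ ⟨
    k * (multiplicity x [ f y ] + multiplicity x (map f ys))
      ≡⟨ cong (k *_) (multiplicity-++ x [ f y ] (map f ys)) ⟨
    k * multiplicity x (map f (y ∷ ys)) ∎
    where open ≡-Reasoning

  unique⇒multiplicity≤1 : ∀ x {xs} → Unique xs → multiplicity x xs ≤ 1
  unique⇒multiplicity≤1 x [] = z≤n
  unique⇒multiplicity≤1 x {y ∷ ys} (y∉ys ∷ ys-unique) with x ≟ y
  ... | yes refl = s≤s (≤-reflexive (cong length (filter-none (x ≟_) y∉ys)))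
  ... | no _     = unique⇒multiplicity≤1 x ys-unique

module _ {r : ℕ} where
  open Multiplicity (VP.≡-dec {n = r} _≟_) public

removeCopies-⊆ : ∀ {r} m (x : Elem r) xs → removeCopies m x xs ⊆ xs
removeCopies-⊆ 0       x xs       = ⊆-refl
removeCopies-⊆ (suc m) x []       = []
removeCopies-⊆ (suc m) x (y ∷ xs) with VP.≡-dec _≟_ x y
... | yes _ = y ∷ʳ removeCopies-⊆ m x xs
... | no _  = refl ∷ removeCopies-⊆ (suc m) x xs

multiplicity-removeCopies : ∀ {r} m (x : Elem r) xs →
  multiplicity x (removeCopies m x xs) ≡ multiplicity x xs ∸ m
multiplicity-removeCopies 0       x xs       = refl
multiplicity-removeCopies (suc m) x []       = refl
multiplicity-removeCopies (suc m) x (y ∷ xs) with VP.≡-dec _≟_ x y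
... | yes refl = multiplicity-removeCopies m x xs
... | no x≢y   = trans (multiplicity-there _ x≢y) (multiplicity-removeCopies (suc m) x xs)

sum-bits≤length : ∀ {xs} → All (_≤ 1) xs → sum xs ≤ length xs
sum-bits≤length []           = z≤n
sum-bits≤length (x≤1 ∷ xs≤1) = +-mono-≤ x≤1 (sum-bits≤length xs≤1)

sum≡0⇒all≡0 : ∀ xs → sum xs ≡ 0 → All (_≡ 0) xs
sum≡0⇒all≡0 []       _   = []
sum≡0⇒all≡0 (x ∷ xs) Σ≡0 = m+n≡0⇒m≡0 x Σ≡0 ∷ sum≡0⇒all≡0 xs (m+n≡0⇒n≡0 x Σ≡0)

sum-bits≡length⇒all≡1 : ∀ {xs} → All (_≤ 1) xs → sum xs ≡ length xs → All (_≡ 1) xs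
sum-bits≡length⇒all≡1 []                    _  = []
sum-bits≡length⇒all≡1 {x ∷ xs} (x≤1 ∷ xs≤1) Σ≡ with m≤n⇒m<n∨m≡n x≤1
... | inj₂ refl      = refl ∷ sum-bits≡length⇒all≡1 xs≤1 (suc-injective Σ≡)
... | inj₁ (s≤s z≤n) = contradiction Σ≡ (<⇒≢ (s≤s (sum-bits≤length xs≤1)))

∣∧<⇒≡0 : ∀ {n s} → n ∣ s → s < n → s ≡ 0
∣∧<⇒≡0 {s = 0}     _   _   = refl
∣∧<⇒≡0 {s = suc _} n∣s s<n = contradiction (∣⇒≤ n∣s) (<⇒≱ s<n)

∣∧>0⇒≤ : ∀ {n s} → n ∣ s → 0 < s → n ≤ s
∣∧>0⇒≤ n∣s (s≤s _) = ∣⇒≤ n∣s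

all≡⇒all≡head : ∀ {a} {A : Set a} {c x : A} {xs} → All (_≡ c) (x ∷ xs) → All (_≡ x) (x ∷ xs)
all≡⇒all≡head all≡c = All.map (λ y≡c → trans y≡c (sym (All.head all≡c))) all≡c

bits-divisible⇒constant : ∀ {n a as} → All (_≤ 1) (a ∷ as) → length (a ∷ as) ≡ n →
  n ∣ sum (a ∷ as) → All (_≡ a) (a ∷ as)
bits-divisible⇒constant bits len≡n n∣Σ
  with m≤n⇒m<n∨m≡n (≤-trans (sum-bits≤length bits) (≤-reflexive len≡n))
... | inj₁ Σ<n = all≡⇒all≡head (sum≡0⇒all≡0 _ (∣∧<⇒≡0 n∣Σ Σ<n))
... | inj₂ Σ≡n = all≡⇒all≡head (sum-bits≡length⇒all≡1 bits (trans Σ≡n (sym len≡n)))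

IsBinary : ∀ {r} → Elem r → Set
IsBinary v = ∀ j → lookup v j ≤ 1

IsNonzeroBinary : ∀ {r} → Elem r → Set
IsNonzeroBinary v = IsBinary v × ∃[ j ] lookup v j ≡ 1

lookup-ext : ∀ {r} {v w : Elem r} → (∀ j → lookup v j ≡ lookup w j) → v ≡ w
lookup-ext {v = v} {w} v≗w = begin
  v                   ≡⟨ VP.tabulate∘lookup v ⟨
  tabulate (lookup v) ≡⟨ VP.tabulate-cong v≗w ⟩
  tabulate (lookup w) ≡⟨ VP.tabulate∘lookup w ⟩
  w                   ∎
  where open ≡-Reasoning

lookup-scal-≡ : ∀ {r} m (i : Fin r) → lookup (scal m i) i ≡ m
lookup-scal-≡ m i = trans (VP.lookup∘tabulate _ i)
  (cong (if_then m else 0) (trans (isYes≗does (i F.≟ i)) (dec-true (i F.≟ i) refl)))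

lookup-scal-≢ : ∀ {r} m {i j : Fin r} → i ≢ j → lookup (scal m i) j ≡ 0
lookup-scal-≢ m {i} {j} i≢j = trans (VP.lookup∘tabulate _ j)
  (cong (if_then m else 0) (trans (isYes≗does (i F.≟ j)) (dec-false (i F.≟ j) i≢j)))

-- e i unfolds to scal 1 i, so the two lemmas above also compute the coordinates of e i.
nonzeroBinary-supported⇒e : ∀ {r} {v : Elem r} {i} → IsNonzeroBinary v →
  (∀ j → j ≢ i → lookup v j ≡ 0) → v ≡ e i
nonzeroBinary-supported⇒e {v = v} {i} (_ , k , vₖ≡1) off-i = lookup-ext coordinate
  where
  coordinate : ∀ j → lookup v j ≡ lookup (e i) j
  coordinate j with j F.≟ i
  ... | no j≢i = trans (off-i j j≢i) (sym (lookup-scal-≢ 1 (j≢i ∘ sym)))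
  ... | yes refl with k F.≟ i
  ...   | yes refl = trans vₖ≡1 (sym (lookup-scal-≡ 1 i))
  ...   | no k≢i   = contradiction (trans (sym vₖ≡1) (off-i k k≢i)) (λ ())

column : ∀ {r} → Fin r → List (Elem r) → List ℕ
column j = map (λ v → lookup v j)

lookup-vsum : ∀ {r} (T : List (Elem r)) j → lookup (vsum T) j ≡ sum (column j T)
lookup-vsum []      j = VP.lookup-replicate j 0
lookup-vsum (v ∷ T) j =
  trans (VP.lookup-zipWith _+_ j v (vsum T)) (cong (lookup v j +_) (lookup-vsum T j))

zeroSum⇒column-divisible : ∀ {r n} {T : List (Elem r)} → IsZeroMod n (vsum T) →
  ∀ j → n ∣ sum (column j T)
zeroSum⇒column-divisible {T = T} T-zero j = subst (_ ∣_) (lookup-vsum T j) (T-zero j)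

column-binary : ∀ {r} {T : List (Elem r)} → All IsNonzeroBinary T → ∀ j → All (_≤ 1) (column j T)
column-binary T-binary j = All.map⁺ (All.map (λ (v-binary , _) → v-binary j) T-binary)

sum-column≤length : ∀ {r} {T : List (Elem r)} → All IsNonzeroBinary T →
  ∀ j → sum (column j T) ≤ length T
sum-column≤length {T = T} T-binary j =
  ≤-trans (sum-bits≤length (column-binary T-binary j)) (≤-reflexive (length-map _ T))

binary-zeroSum⇒constant : ∀ {r n} {x : Elem r} {T} → All IsNonzeroBinary (x ∷ T) →
  length (x ∷ T) ≤ n → IsZeroMod n (vsum (x ∷ T)) → length (x ∷ T) ≡ n × All (_≡ x) (x ∷ T)
binary-zeroSum⇒constant {n = n} {x} {T} xT-binary@((_ , k , xₖ≡1) ∷ _) len≤n xT-zero =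
  len≡n , All.tabulate (λ y∈xT → lookup-ext (λ j → All.lookup (column-constant j) (∈-map⁺ _ y∈xT)))
  where
  divisible = zeroSum⇒column-divisible {T = x ∷ T} xT-zero
  len≡n : length (x ∷ T) ≡ n
  len≡n = ≤-antisym len≤n (begin
    n                      ≤⟨ ∣∧>0⇒≤ (divisible k) (≤-trans (≤-reflexive (sym xₖ≡1)) (m≤m+n _ _)) ⟩
    sum (column k (x ∷ T)) ≤⟨ sum-column≤length xT-binary k ⟩
    length (x ∷ T)         ∎)
    where open ≤-Reasoning
  column-constant : ∀ j → All (_≡ lookup x j) (column j (x ∷ T))
  column-constant j = bits-divisible⇒constant (column-binary xT-binary j)
    (trans (length-map _ (x ∷ T)) len≡n) (divisible j)

scal∷binary-zeroSum⇒all≡e : ∀ {r n} m (i : Fin r) {U} → All IsNonzeroBinary U → length U < n →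
  IsZeroMod n (vsum (scal m i ∷ U)) → All (_≡ e i) U
scal∷binary-zeroSum⇒all≡e {n = n} m i {U} U-binary len<n sU-zero =
  All.tabulate (λ y∈U → nonzeroBinary-supported⇒e (All.lookup U-binary y∈U)
    (λ j j≢i → All.lookup (off-axis-zero j j≢i) (∈-map⁺ _ y∈U)))
  where
  off-axis-zero : ∀ j → j ≢ i → All (_≡ 0) (column j U)
  off-axis-zero j j≢i = sum≡0⇒all≡0 _
    (∣∧<⇒≡0 n∣Σ (≤-<-trans (sum-column≤length U-binary j) len<n))
    where
    n∣Σ : n ∣ sum (column j U)
    n∣Σ = subst (n ∣_) (cong (_+ sum (column j U)) (lookup-scal-≢ m (j≢i ∘ sym)))
      (zeroSum⇒column-divisible {T = scal m i ∷ U} sU-zero j)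

binary-multiplicity<⇒zeroSum-free : ∀ {r n} {L : List (Elem r)} → All IsNonzeroBinary L →
  (∀ x → multiplicity x L < n) → ¬ HasShortZeroSum n L
binary-multiplicity<⇒zeroSum-free {n = n} {L} L-binary mult<n (x ∷ T , xT⊆L , _ , len≤n , xT-zero)
  with binary-zeroSum⇒constant (All-resp-⊆ xT⊆L L-binary) len≤n xT-zero
... | len≡n , xT≡x = <⇒≱ (mult<n x) (begin
  n                      ≡⟨ len≡n ⟨
  length (x ∷ T)         ≡⟨ all≡⇒multiplicity≡length xT≡x ⟨
  multiplicity x (x ∷ T) ≤⟨ multiplicity-mono x xT⊆L ⟩
  multiplicity x L       ∎)
  where open ≤-Reasoning

scal∷binary-not-zeroSum : ∀ {r n m} (i : Fin r) {L U : List (Elem r)} → All IsNonzeroBinary L →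
  1 ≤ m → m + multiplicity (e i) L < n → U ⊆ L → length U < n →
  ¬ IsZeroMod n (vsum (scal m i ∷ U))
scal∷binary-not-zeroSum {n = n} {m} i {L} {U} L-binary 1≤m m+mult<n U⊆L len<n sU-zero =
  <⇒≢ 1≤m (sym m≡0)
  where
  U-binary = All-resp-⊆ U⊆L L-binary
  U≡e = scal∷binary-zeroSum⇒all≡e m i U-binary len<n sU-zero
  Σ<n : lookup (scal m i) i + sum (column i U) < n
  Σ<n = begin-strict
    lookup (scal m i) i + sum (column i U) ≡⟨ cong (_+ sum (column i U)) (lookup-scal-≡ m i) ⟩
    m + sum (column i U)                   ≤⟨ +-monoʳ-≤ m (sum-column≤length U-binary i) ⟩
    m + length U                           ≡⟨ cong (m +_) (all≡⇒multiplicity≡length U≡e) ⟨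
    m + multiplicity (e i) U               ≤⟨ +-monoʳ-≤ m (multiplicity-mono (e i) U⊆L) ⟩
    m + multiplicity (e i) L               <⟨ m+mult<n ⟩
    n                                      ∎
    where open ≤-Reasoning
  m≡0 : m ≡ 0
  m≡0 = trans (sym (lookup-scal-≡ m i))
    (m+n≡0⇒m≡0 _ (∣∧<⇒≡0 (zeroSum⇒column-divisible {T = scal m i ∷ U} sU-zero i) Σ<n))

scal∷binary-zeroSum-free : ∀ {r n m} (i : Fin r) {L : List (Elem r)} → All IsNonzeroBinary L →
  (∀ x → multiplicity x L < n) → 1 ≤ m → m + multiplicity (e i) L < n →
  ¬ HasShortZeroSum n (scal m i ∷ L)
scal∷binary-zeroSum-free i L-binary mult<n 1≤m m+mult<n (T , T⊆ , 1≤|T| , |T|≤n , T-zero)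
  with T⊆
... | _ ∷ʳ T⊆L   = binary-multiplicity<⇒zeroSum-free L-binary mult<n (T , T⊆L , 1≤|T| , |T|≤n , T-zero)
... | refl ∷ U⊆L = scal∷binary-not-zeroSum i L-binary 1≤m m+mult<n U⊆L |T|≤n T-zero

indicator-injective : ∀ {r} {s t : Vec Bool r} → indicator s ≡ indicator t → s ≡ t
indicator-injective {s = []}    {[]}    _  = refl
indicator-injective {s = a ∷ s} {b ∷ t} eq =
  cong₂ _∷_ (bit-injective a b (VP.∷-injectiveˡ eq)) (indicator-injective (VP.∷-injectiveʳ eq))
  where
  bit-injective : ∀ a b → (if a then 1 else 0) ≡ (if b then 1 else 0) → a ≡ b
  bit-injective true  true  _ = refl
  bit-injective false false _ = refl

subsets-unique : ∀ r → Unique (subsets r)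
subsets-unique 0       = [] ∷ []
subsets-unique (suc r) = Unique.++⁺ (Unique.map⁺ VP.∷-injectiveʳ (subsets-unique r))
  (Unique.map⁺ VP.∷-injectiveʳ (subsets-unique r)) heads-differ
  where
  heads-differ : Disjoint (map (false ∷_) (subsets r)) (map (true ∷_) (subsets r))
  heads-differ (v∈false , v∈true) with ∈-map⁻ _ v∈false | ∈-map⁻ _ v∈true
  ... | _ , _ , refl | _ , _ , ()

multiplicity-S : ∀ n r x → multiplicity x (S n r) ≤ n ∸ 1
multiplicity-S n r x = begin
  multiplicity x (S n r)
    ≡⟨ multiplicity-concatMap-replicate x (n ∸ 1) indicator (nonemptySubsets r) ⟩
  (n ∸ 1) * multiplicity x (map indicator (nonemptySubsets r))
    ≤⟨ *-monoʳ-≤ (n ∸ 1) (unique⇒multiplicity≤1 x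
         (Unique.map⁺ indicator-injective (Unique.filter⁺ _ (subsets-unique r)))) ⟩
  (n ∸ 1) * 1
    ≡⟨ *-identityʳ (n ∸ 1) ⟩
  n ∸ 1 ∎
  where open ≤-Reasoning

indicator-binary : ∀ {r} (s : Vec Bool r) → IsBinary (indicator s)
indicator-binary s j rewrite VP.lookup-map j (λ b → if b then 1 else 0) s = bit≤1 (lookup s j)
  where
  bit≤1 : ∀ b → (if b then 1 else 0) ≤ 1
  bit≤1 true  = ≤-refl
  bit≤1 false = z≤n

indicator-nonzero : ∀ {r} (s : Vec Bool r) → nonempty s ≡ true →
  ∃[ j ] lookup (indicator s) j ≡ 1
indicator-nonzero (true ∷ s)  _          = F.zero , refl
indicator-nonzero (false ∷ s) s-nonempty with indicator-nonzero s s-nonempty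
... | j , sⱼ≡1 = F.suc j , sⱼ≡1

S-nonzeroBinary : ∀ n r → All IsNonzeroBinary (S n r)
S-nonzeroBinary n r = All.concat⁺ (All.map⁺ (All.map
  (λ {s} s-nonempty → All.replicate⁺ (n ∸ 1) (indicator-binary s , indicator-nonzero s s-nonempty))
  (All.all-filter _ (subsets r))))

lemma3p3 : (n r : ℕ) → 2 ≤ n → 2 ≤ r → (m : ℕ) → 1 ≤ m → m < n → (i : Fin r) →
    ¬ HasShortZeroSum n (scal m i ∷ removeCopies m (e i) (S n r))
lemma3p3 n@(suc n-1) r _ _ m 1≤m (s≤s m≤n-1) i =
  scal∷binary-zeroSum-free i L-binary multiplicity<n 1≤m m+multiplicity<n
  where
  L = removeCopies m (e i) (S n r)
  L⊆S = removeCopies-⊆ m (e i) (S n r)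
  L-binary : All IsNonzeroBinary L
  L-binary = All-resp-⊆ L⊆S (S-nonzeroBinary n r)
  multiplicity<n : ∀ x → multiplicity x L < n
  multiplicity<n x = s≤s (≤-trans (multiplicity-mono x L⊆S) (multiplicity-S n r x))
  m+multiplicity<n : m + multiplicity (e i) L < n
  m+multiplicity<n = s≤s (begin
    m + multiplicity (e i) L             ≡⟨ cong (m +_) (multiplicity-removeCopies m (e i) (S n r)) ⟩
    m + (multiplicity (e i) (S n r) ∸ m) ≤⟨ +-monoʳ-≤ m (∸-monoˡ-≤ m (multiplicity-S n r (e i))) ⟩
    m + (n-1 ∸ m)                        ≡⟨ m+[n∸m]≡n m≤n-1 ⟩
    n-1                                  ∎)
    where open ≤-Reasoning
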